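{- Let $d,t,m,k$ be positive integers and let $\mathcal{S}=(S_1,\ldots,S_m)$ be a sequence of subsets of $\{1,\ldots,d-1\}$, each of size exactly $t$. For $x\in\{0,1\}^{d-1}$ let $T(x)=\{1\le i\le m : x_j=1 \text{ for all } j\in S_i\}$, and define $f:\{0,1\}^{d-1}\times\{0,1\}^m\to\{0,1\}$ by $f(x,y)=1$ if $|T(x)|\ge 2$, $f(x,y)=0$ if $|T(x)|=0$, and $f(x,y)=y_i$ if $T(x)=\{i\}$. Then for every $k$-junta $g:\{0,1\}^{d-1}\times\{0,1\}^m\to\{0,1\}$, $$\Pr_{x,y}(f(x,y)\ne g(x,y))\ \ge\ \frac{\Pr_x(|T(x)|=1)-k2^{ -t}}{2},$$ where $x$ and $y$ are independent and uniform on $\{0,1\}^{d-1}$ and $\{0,1\}^m$ respectively.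
   Context: A $k$-junta is a function depending on at most $k$ of its input coordinates. -}

module Defs where

open import Data.Bool using (Bool; true; false; not; _∨_; _∧_)
open import Data.Nat using (ℕ; zero; suc; _+_; _^_; _≤_)
open import Data.Nat.Properties using (m^n≢0)
open import Data.Integer using (+_)
open import Data.Rational using (ℚ; _/_)
open import Data.Fin using (Fin)
open import Data.Fin.Subset using (Subset; _∈_; ∣_∣)
open import Data.Vec using (Vec; []; _∷_; lookup; _++_; foldr; zipWith)
open import Data.List using (List; []; _∷_; length; filter; map; concatMap; cartesianProduct)
open import Data.List as L using ()
open import Data.Product using (Σ; _×_; _,_; ∃)
open import Relation.Binary.PropositionalEquality using (_≡_; _≢_)
open import Relation.Nullary.Decidable using (¬?)
open import Data.Bool.Properties using () renaming (_≟_ to _≟B_)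
open import Data.Nat.Properties using () renaming (_≟_ to _≟ℕ_)

cube : (n : ℕ) → List (Vec Bool n)
cube zero = [] ∷ []
cube (suc n) = concatMap (λ v → (false ∷ v) ∷ (true ∷ v) ∷ []) (cube n)

countCube : (n : ℕ) → (Vec Bool n → Bool) → ℕ
countCube n b = length (filter (λ x → b x ≟B true) (cube n))

Pr : (n : ℕ) → (Vec Bool n → Bool) → ℚ
Pr n b = _/_ (+ countCube n b) (2 ^ n) {{m^n≢0 2 n}}

allOnes : {n : ℕ} → Subset n → Vec Bool n → Bool
allOnes S x = foldr _ _∧_ true (zipWith (λ s b → not s ∨ b) S x)

T : {n m : ℕ} → (Fin m → Subset n) → Vec Bool n → List (Fin m)
T {m = m} S x = filter (λ i → allOnes (S i) x ≟B true) (Data.List.allFin m)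
  where import Data.List

f : {n m : ℕ} → (Fin m → Subset n) → Vec Bool n → Vec Bool m → Bool
f S x y with T S x
... | [] = false
... | i ∷ [] = lookup y i
... | _ ∷ _ ∷ _ = true

IsJunta : {n m : ℕ} → ℕ → (Vec Bool n → Vec Bool m → Bool) → Set
IsJunta {n} {m} k g =
  Σ (Subset (n + m)) λ J → (∣ J ∣ ≤ k) ×
    (∀ x x′ y y′ → (∀ i → i ∈ J → lookup (x ++ y) i ≡ lookup (x′ ++ y′) i) → g x y ≡ g x′ y′)

-- split z ∈ {0,1}^(n+m) as (x , y); the uniform measure on {0,1}^(n+m)
-- is the product of the uniform measures on {0,1}^n and {0,1}^m
split : (n : ℕ) {m : ℕ} → Vec Bool (n + m) → Vec Bool n × Vec Bool m
split n z = Data.Vec.take n z , Data.Vec.drop n z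
  where import Data.Vec

|T|≡1 : {n m : ℕ} → (Fin m → Subset n) → Vec Bool n → Bool
|T|≡1 S x = Relation.Nullary.Decidable.⌊ length (T S x) ≟ℕ 1 ⌋
  where import Relation.Nullary.Decidable

module Submission where

-- Write n = d ∸ 1, identify probabilities with point counts, and let J be the
-- coordinate set of the junta g.  Fix x with T(x) = {i}, so f(x, y) = y_i.
--   * If the y-coordinate i is not in J, then y ↦ g(x, y) ignores y_i, and
--     f(x, ·) ≠ g(x, ·) on exactly half of {0,1}^m.
--   * Otherwise x is all ones on S_i for some i with n + i ∈ J: x is "hit".
-- Summing over x:  #{|T| = 1}·2^m ≤ 2·#{f ≠ g} + 2^m·#hits, and since each of
-- the at most k such i is hit by the 2^(n-t) points of a subcube,
-- #hits·2^t ≤ k·2^n.  Together these give the theorem with denominators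
-- cleared, and dividing by 2^n·2^m·2^t·2 gives the rational statement.

module Counting where
  open import Defs
  open import Data.Bool using (Bool; true; false; not; _xor_)
  open import Data.Bool.Properties using () renaming (_≟_ to _≟B_)
  open import Data.Empty using (⊥-elim)
  open import Function using (_∘_)
  open import Data.Fin using (Fin; zero; suc; _↑ʳ_)
  open import Data.Fin.Subset using (Subset; ∣_∣; _∈_)
  open import Data.List using (List; []; _∷_; length; filter; map; concatMap; allFin) renaming (_++_ to _++ᴸ_)
  open import Data.List.Properties using (map-++)
  open import Data.List.Membership.Propositional using () renaming (_∈_ to _∈ᴸ_)
  open import Data.List.Membership.Propositional.Properties using (∈-filter⁻)
  open import Data.List.Relation.Unary.Any using (here)
  open import Data.Nat
  open import Data.Nat.ListAction using (sum)
  open import Data.Nat.ListAction.Properties using (sum-++)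
  open import Data.Nat.Properties
  open import Data.Nat.Tactic.RingSolver using (solve-∀)
  open import Data.Product using (_,_; proj₁; proj₂)
  open import Data.Vec using (Vec; []; _∷_; lookup; _++_)
  open import Data.Vec.Properties using ([]=⇒lookup)
  open import Relation.Binary.PropositionalEquality

  𝟙 : Bool → ℕ
  𝟙 true = 1
  𝟙 false = 0

  cubeSum : (n : ℕ) → (Vec Bool n → ℕ) → ℕ
  cubeSum zero h = h []
  cubeSum (suc n) h = cubeSum n (λ x → h (false ∷ x)) + cubeSum n (λ x → h (true ∷ x))

  cubeSum-cong : ∀ n {h h′ : Vec Bool n → ℕ} → (∀ x → h x ≡ h′ x) → cubeSum n h ≡ cubeSum n h′
  cubeSum-cong zero e = e []
  cubeSum-cong (suc n) e = cong₂ _+_ (cubeSum-cong n (λ x → e (false ∷ x))) (cubeSum-cong n (λ x → e (true ∷ x)))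

  cubeSum-mono : ∀ n {h h′ : Vec Bool n → ℕ} → (∀ x → h x ≤ h′ x) → cubeSum n h ≤ cubeSum n h′
  cubeSum-mono zero e = e []
  cubeSum-mono (suc n) e =
    +-mono-≤ (cubeSum-mono n (λ x → e (false ∷ x))) (cubeSum-mono n (λ x → e (true ∷ x)))

  cubeSum-+ : ∀ n (h h′ : Vec Bool n → ℕ) → cubeSum n (λ x → h x + h′ x) ≡ cubeSum n h + cubeSum n h′
  cubeSum-+ zero h h′ = refl
  cubeSum-+ (suc n) h h′ = begin
    cubeSum n (λ x → h (false ∷ x) + h′ (false ∷ x)) + cubeSum n (λ x → h (true ∷ x) + h′ (true ∷ x))
      ≡⟨ cong₂ _+_ (cubeSum-+ n _ _) (cubeSum-+ n _ _) ⟩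
    (h₀ + h′₀) + (h₁ + h′₁)  ≡⟨ +-comm-middle h₀ h′₀ h₁ h′₁ ⟩
    (h₀ + h₁) + (h′₀ + h′₁)  ∎
    where
    open ≡-Reasoning
    h₀ h₁ h′₀ h′₁ : ℕ
    h₀ = cubeSum n (λ x → h (false ∷ x))
    h₁ = cubeSum n (λ x → h (true ∷ x))
    h′₀ = cubeSum n (λ x → h′ (false ∷ x))
    h′₁ = cubeSum n (λ x → h′ (true ∷ x))
    +-comm-middle : ∀ a b c d → (a + b) + (c + d) ≡ (a + c) + (b + d)
    +-comm-middle = solve-∀

  cubeSum-*ˡ : ∀ n c (h : Vec Bool n → ℕ) → cubeSum n (λ x → c * h x) ≡ c * cubeSum n h
  cubeSum-*ˡ zero c h = refl
  cubeSum-*ˡ (suc n) c h =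
    trans (cong₂ _+_ (cubeSum-*ˡ n c _) (cubeSum-*ˡ n c _)) (sym (*-distribˡ-+ c _ _))

  cubeSum-*ʳ : ∀ n c (h : Vec Bool n → ℕ) → cubeSum n (λ x → h x * c) ≡ cubeSum n h * c
  cubeSum-*ʳ n c h = begin
    cubeSum n (λ x → h x * c)  ≡⟨ cubeSum-cong n (λ x → *-comm (h x) c) ⟩
    cubeSum n (λ x → c * h x)  ≡⟨ cubeSum-*ˡ n c h ⟩
    c * cubeSum n h            ≡⟨ *-comm c _ ⟩
    cubeSum n h * c            ∎
    where open ≡-Reasoning

  cubeSum-const : ∀ n c → cubeSum n (λ _ → c) ≡ c * 2 ^ n
  cubeSum-const zero c = sym (*-identityʳ c)
  cubeSum-const (suc n) c = begin
    cubeSum n (λ _ → c) + cubeSum n (λ _ → c)  ≡⟨ cong₂ _+_ (cubeSum-const n c) (cubeSum-const n c) ⟩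
    c * 2 ^ n + c * 2 ^ n                      ≡⟨ sym (*-distribˡ-+ c (2 ^ n) _) ⟩
    c * (2 ^ n + 2 ^ n)                        ≡⟨ cong (λ s → c * (2 ^ n + s)) (sym (+-identityʳ _)) ⟩
    c * 2 ^ suc n                              ∎
    where open ≡-Reasoning

  cubeSum-split : ∀ n m (h : Vec Bool n → Vec Bool m → ℕ) →
    cubeSum (n + m) (λ z → h (proj₁ (split n z)) (proj₂ (split n z)))
      ≡ cubeSum n (λ x → cubeSum m (h x))
  cubeSum-split zero m h = refl
  cubeSum-split (suc n) m h =
    cong₂ _+_ (cubeSum-split n m (λ x → h (false ∷ x))) (cubeSum-split n m (λ x → h (true ∷ x)))

  sum-concatMap : ∀ {A B : Set} (φ : A → List B) (h : B → ℕ) (l : List A) →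
    sum (map h (concatMap φ l)) ≡ sum (map (λ a → sum (map h (φ a))) l)
  sum-concatMap φ h [] = refl
  sum-concatMap φ h (a ∷ l) = begin
    sum (map h (φ a ++ᴸ concatMap φ l))
      ≡⟨ cong sum (map-++ h (φ a) (concatMap φ l)) ⟩
    sum (map h (φ a) ++ᴸ map h (concatMap φ l))
      ≡⟨ sum-++ (map h (φ a)) _ ⟩
    sum (map h (φ a)) + sum (map h (concatMap φ l))
      ≡⟨ cong (sum (map h (φ a)) +_) (sum-concatMap φ h l) ⟩
    sum (map h (φ a)) + sum (map (λ a → sum (map h (φ a))) l) ∎
    where open ≡-Reasoning

  sum-cube : ∀ n (h : Vec Bool n → ℕ) → sum (map h (cube n)) ≡ cubeSum n h
  sum-cube zero h = +-identityʳ (h [])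
  sum-cube (suc n) h = begin
    sum (map h (cube (suc n)))
      ≡⟨ sum-concatMap _ h (cube n) ⟩
    sum (map (λ x → h (false ∷ x) + (h (true ∷ x) + 0)) (cube n))
      ≡⟨ sum-cube n _ ⟩
    cubeSum n (λ x → h (false ∷ x) + (h (true ∷ x) + 0))
      ≡⟨ cubeSum-cong n (λ x → cong (h (false ∷ x) +_) (+-identityʳ _)) ⟩
    cubeSum n (λ x → h (false ∷ x) + h (true ∷ x))
      ≡⟨ cubeSum-+ n _ _ ⟩
    cubeSum (suc n) h ∎
    where open ≡-Reasoning

  length-filter-𝟙 : ∀ {A : Set} (b : A → Bool) (l : List A) →
    length (filter (λ x → b x ≟B true) l) ≡ sum (map (λ x → 𝟙 (b x)) l)
  length-filter-𝟙 b [] = refl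
  length-filter-𝟙 b (a ∷ l) with b a
  ... | true = cong suc (length-filter-𝟙 b l)
  ... | false = length-filter-𝟙 b l

  countCube≡cubeSum : ∀ n (b : Vec Bool n → Bool) → countCube n b ≡ cubeSum n (λ x → 𝟙 (b x))
  countCube≡cubeSum n b = trans (length-filter-𝟙 b (cube n)) (sum-cube n _)

  finSum : (m : ℕ) → (Fin m → ℕ) → ℕ
  finSum zero h = 0
  finSum (suc m) h = h zero + finSum m (λ i → h (suc i))

  finSum-cong : ∀ m {h h′ : Fin m → ℕ} → (∀ i → h i ≡ h′ i) → finSum m h ≡ finSum m h′
  finSum-cong zero e = refl
  finSum-cong (suc m) e = cong₂ _+_ (e zero) (finSum-cong m (λ i → e (suc i)))

  finSum-*ʳ : ∀ m c (h : Fin m → ℕ) → finSum m (λ i → h i * c) ≡ finSum m h * c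
  finSum-*ʳ zero c h = refl
  finSum-*ʳ (suc m) c h =
    trans (cong (h zero * c +_) (finSum-*ʳ m c _)) (sym (*-distribʳ-+ c (h zero) _))

  term≤finSum : ∀ m (h : Fin m → ℕ) i → h i ≤ finSum m h
  term≤finSum (suc m) h zero = m≤m+n (h zero) _
  term≤finSum (suc m) h (suc i) = ≤-trans (term≤finSum m (λ j → h (suc j)) i) (m≤n+m _ (h zero))

  cubeSum-finSum : ∀ n m (h : Fin m → Vec Bool n → ℕ) →
    cubeSum n (λ x → finSum m (λ i → h i x)) ≡ finSum m (λ i → cubeSum n (h i))
  cubeSum-finSum n zero h = cubeSum-const n 0
  cubeSum-finSum n (suc m) h =
    trans (cubeSum-+ n (h zero) _) (cong (cubeSum n (h zero) +_) (cubeSum-finSum n m (λ i → h (suc i))))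

  ∣∣≡finSum : ∀ m (J : Subset m) → ∣ J ∣ ≡ finSum m (λ i → 𝟙 (lookup J i))
  ∣∣≡finSum zero [] = refl
  ∣∣≡finSum (suc m) (true ∷ J) = cong suc (∣∣≡finSum m J)
  ∣∣≡finSum (suc m) (false ∷ J) = ∣∣≡finSum m J

  finSum-↑ʳ≤∣∣ : ∀ n m (J : Subset (n + m)) → finSum m (λ i → 𝟙 (lookup J (n ↑ʳ i))) ≤ ∣ J ∣
  finSum-↑ʳ≤∣∣ zero m J = ≤-reflexive (sym (∣∣≡finSum m J))
  finSum-↑ʳ≤∣∣ (suc n) m (true ∷ J) = m≤n⇒m≤1+n (finSum-↑ʳ≤∣∣ n m J)
  finSum-↑ʳ≤∣∣ (suc n) m (false ∷ J) = finSum-↑ʳ≤∣∣ n m J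

  subcube-size : ∀ n (S : Subset n) → cubeSum n (λ x → 𝟙 (allOnes S x)) * 2 ^ ∣ S ∣ ≡ 2 ^ n
  subcube-size zero [] = refl
  subcube-size (suc n) (true ∷ S) = begin
    (cubeSum n (λ _ → 0) + c) * (2 * 2 ^ ∣ S ∣)  ≡⟨ cong (λ z → (z + c) * (2 * 2 ^ ∣ S ∣)) (cubeSum-const n 0) ⟩
    c * (2 * 2 ^ ∣ S ∣)                        ≡⟨ swap c (2 ^ ∣ S ∣) ⟩
    2 * (c * 2 ^ ∣ S ∣)                        ≡⟨ cong (2 *_) (subcube-size n S) ⟩
    2 * 2 ^ n                                  ∎
    where
    open ≡-Reasoning
    c : ℕ
    c = cubeSum n (λ x → 𝟙 (allOnes S x))
    swap : ∀ a b → a * (2 * b) ≡ 2 * (a * b)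
    swap = solve-∀
  subcube-size (suc n) (false ∷ S) = begin
    (c + c) * 2 ^ ∣ S ∣              ≡⟨ *-distribʳ-+ (2 ^ ∣ S ∣) c c ⟩
    c * 2 ^ ∣ S ∣ + c * 2 ^ ∣ S ∣    ≡⟨ cong₂ _+_ (subcube-size n S) (subcube-size n S) ⟩
    2 ^ n + 2 ^ n                    ≡⟨ cong (2 ^ n +_) (sym (+-identityʳ (2 ^ n))) ⟩
    2 * 2 ^ n                        ∎
    where
    open ≡-Reasoning
    c : ℕ
    c = cubeSum n (λ x → 𝟙 (allOnes S x))

  AgreeOff : ∀ {m} → Fin m → Vec Bool m → Vec Bool m → Set
  AgreeOff i y y′ = ∀ j → j ≢ i → lookup y j ≡ lookup y′ j

  IgnoresCoord : ∀ {m} → Fin m → (Vec Bool m → Bool) → Set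
  IgnoresCoord i h = ∀ y y′ → AgreeOff i y y′ → h y ≡ h y′

  -- if h ignores coordinate i, then h(y) ≠ y_i on exactly half of the cube:
  -- flipping y_i is a bijection between agreements and disagreements
  halfDisagree : ∀ m (i : Fin m) (h : Vec Bool m → Bool) → IgnoresCoord i h →
    2 * cubeSum m (λ y → 𝟙 (lookup y i xor h y)) ≡ 2 ^ m
  halfDisagree (suc m) zero h ignores = cong (2 *_) (begin
    cubeSum m (λ y → 𝟙 (h (false ∷ y))) + cubeSum m (λ y → 𝟙 (not (h (true ∷ y))))
      ≡⟨ cong (cubeSum m (λ y → 𝟙 (h (false ∷ y))) +_) (cubeSum-cong m (λ y → cong (𝟙 ∘ not) (flip y))) ⟩
    cubeSum m (λ y → 𝟙 (h (false ∷ y))) + cubeSum m (λ y → 𝟙 (not (h (false ∷ y))))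
      ≡⟨ sym (cubeSum-+ m _ _) ⟩
    cubeSum m (λ y → 𝟙 (h (false ∷ y)) + 𝟙 (not (h (false ∷ y))))
      ≡⟨ cubeSum-cong m (λ y → 𝟙b+𝟙¬b (h (false ∷ y))) ⟩
    cubeSum m (λ _ → 1)
      ≡⟨ trans (cubeSum-const m 1) (*-identityˡ _) ⟩
    2 ^ m ∎)
    where
    open ≡-Reasoning
    flip : ∀ y → h (true ∷ y) ≡ h (false ∷ y)
    flip y = ignores (true ∷ y) (false ∷ y) λ { zero 0≢0 → ⊥-elim (0≢0 refl) ; (suc j) _ → refl }
    𝟙b+𝟙¬b : ∀ b → 𝟙 b + 𝟙 (not b) ≡ 1
    𝟙b+𝟙¬b true = refl
    𝟙b+𝟙¬b false = refl
  halfDisagree (suc m) (suc i) h ignores = begin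
    2 * (half₀ + half₁)    ≡⟨ *-distribˡ-+ 2 half₀ half₁ ⟩
    2 * half₀ + 2 * half₁  ≡⟨ cong₂ _+_ (halfDisagree m i _ (ignoresTail false)) (halfDisagree m i _ (ignoresTail true)) ⟩
    2 ^ m + 2 ^ m          ≡⟨ cong (2 ^ m +_) (sym (+-identityʳ (2 ^ m))) ⟩
    2 * 2 ^ m              ∎
    where
    open ≡-Reasoning
    half₀ = cubeSum m (λ y → 𝟙 (lookup y i xor h (false ∷ y)))
    half₁ = cubeSum m (λ y → 𝟙 (lookup y i xor h (true ∷ y)))
    ignoresTail : ∀ b → IgnoresCoord i (λ y → h (b ∷ y))
    ignoresTail b y y′ agree = ignores (b ∷ y) (b ∷ y′) λ
      { zero _ → refl
      ; (suc j) j≢i → agree j (λ j≡i → j≢i (cong suc j≡i)) }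

  DeterminedBy : ∀ {n m} → Subset (n + m) → (Vec Bool n → Vec Bool m → Bool) → Set
  DeterminedBy J g =
    ∀ x x′ y y′ → (∀ i → i ∈ J → lookup (x ++ y) i ≡ lookup (x′ ++ y′) i) → g x y ≡ g x′ y′

  ++-agreeOff : ∀ {n m} (x : Vec Bool n) {y y′ : Vec Bool m} {i : Fin m} →
    AgreeOff i y y′ → AgreeOff (n ↑ʳ i) (x ++ y) (x ++ y′)
  ++-agreeOff [] agree = agree
  ++-agreeOff (a ∷ x) agree zero _ = refl
  ++-agreeOff (a ∷ x) agree (suc j) j≢i = ++-agreeOff x agree j (λ j≡i → j≢i (cong suc j≡i))

  ignoresOutside : ∀ {n m} {J : Subset (n + m)} {g : Vec Bool n → Vec Bool m → Bool} →
    DeterminedBy J g → ∀ x i → lookup J (n ↑ʳ i) ≡ false → IgnoresCoord i (g x)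
  ignoresOutside {J = J} determined x i i∉J y y′ agree =
    determined x x y y′ λ j j∈J → ++-agreeOff x agree j λ j≡ →
      false≢true (trans (sym i∉J) (trans (cong (lookup J) (sym j≡)) ([]=⇒lookup j∈J)))
    where
    false≢true : false ≢ true
    false≢true ()

  T-singleton : ∀ {n m} (S : Fin m → Subset n) x i → T S x ≡ i ∷ [] → allOnes (S i) x ≡ true
  T-singleton {m = m} S x i T≡[i] =
    proj₂ (∈-filter⁻ (λ j → allOnes (S j) x ≟B true) {i} {allFin m} (subst (i ∈ᴸ_) (sym T≡[i]) (here refl)))

  hits : ∀ {n m} → Subset (n + m) → (Fin m → Subset n) → Vec Bool n → ℕ
  hits {n} {m} J S x = finSum m (λ i → 𝟙 (lookup J (n ↑ʳ i)) * 𝟙 (allOnes (S i) x))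

  fibreErrors : ∀ {n m} → (Fin m → Subset n) → (Vec Bool n → Vec Bool m → Bool) → Vec Bool n → ℕ
  fibreErrors {m = m} S g x = cubeSum m (λ y → 𝟙 (f S x y xor g x y))

  -- on the fibre over x with T(x) = {i}: either y_i is invisible to g, and half of
  -- the fibre is an error, or n + i ∈ J, and x is counted by hits
  fibre-bound : ∀ {n m} (S : Fin m → Subset n) {J : Subset (n + m)} {g : Vec Bool n → Vec Bool m → Bool} →
    DeterminedBy J g → ∀ x → 𝟙 (|T|≡1 S x) * 2 ^ m ≤ 2 * fibreErrors S g x + 2 ^ m * hits J S x
  fibre-bound {n} {m} S {J} {g} determined x with T S x in T≡
  ... | [] = z≤n
  ... | _ ∷ _ ∷ _ = z≤n
  ... | i ∷ [] with lookup J (n ↑ʳ i) in i∈J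
  ...   | false = ≤-trans (≤-reflexive halfFibre) (m≤m+n _ _)
    where
    halfFibre : 2 ^ m + 0 ≡ 2 * cubeSum m (λ y → 𝟙 (lookup y i xor g x y))
    halfFibre = trans (+-identityʳ _) (sym (halfDisagree m i (g x) (ignoresOutside determined x i i∈J)))
  ...   | true = ≤-trans xHit (m≤n+m _ _)
    where
    open ≤-Reasoning
    i-hit : 1 ≤ hits J S x
    i-hit = subst (_≤ hits J S x) (cong₂ (λ a b → 𝟙 a * 𝟙 b) i∈J (T-singleton S x i T≡))
      (term≤finSum m _ i)
    xHit : 2 ^ m + 0 ≤ 2 ^ m * hits J S x
    xHit = begin
      2 ^ m + 0           ≡⟨ +-identityʳ _ ⟩
      2 ^ m               ≡⟨ sym (*-identityʳ _) ⟩
      2 ^ m * 1           ≤⟨ *-monoʳ-≤ (2 ^ m) i-hit ⟩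
      2 ^ m * hits J S x  ∎

  errorEvent : ∀ {n m} → (Fin m → Subset n) → (Vec Bool n → Vec Bool m → Bool) → Vec Bool (n + m) → Bool
  errorEvent {n} S g z = f S (proj₁ (split n z)) (proj₂ (split n z)) xor g (proj₁ (split n z)) (proj₂ (split n z))

  error-bound : ∀ {n m} (S : Fin m → Subset n) {J : Subset (n + m)} {g : Vec Bool n → Vec Bool m → Bool} →
    DeterminedBy J g →
    countCube n (|T|≡1 S) * 2 ^ m ≤ 2 * countCube (n + m) (errorEvent S g) + 2 ^ m * cubeSum n (hits J S)
  error-bound {n} {m} S {J} {g} determined = begin
    countCube n (|T|≡1 S) * 2 ^ m
      ≡⟨ cong (_* 2 ^ m) (countCube≡cubeSum n _) ⟩
    cubeSum n (λ x → 𝟙 (|T|≡1 S x)) * 2 ^ m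
      ≡⟨ sym (cubeSum-*ʳ n _ _) ⟩
    cubeSum n (λ x → 𝟙 (|T|≡1 S x) * 2 ^ m)
      ≤⟨ cubeSum-mono n (fibre-bound S determined) ⟩
    cubeSum n (λ x → 2 * fibreErrors S g x + 2 ^ m * hits J S x)
      ≡⟨ cubeSum-+ n _ _ ⟩
    cubeSum n (λ x → 2 * fibreErrors S g x) + cubeSum n (λ x → 2 ^ m * hits J S x)
      ≡⟨ cong₂ _+_ (cubeSum-*ˡ n 2 _) (cubeSum-*ˡ n (2 ^ m) _) ⟩
    2 * cubeSum n (fibreErrors S g) + 2 ^ m * cubeSum n (hits J S)
      ≡⟨ cong (λ e → 2 * e + 2 ^ m * cubeSum n (hits J S)) (sym errors) ⟩
    2 * countCube (n + m) (errorEvent S g) + 2 ^ m * cubeSum n (hits J S) ∎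
    where
    open ≤-Reasoning
    errors : countCube (n + m) (errorEvent S g) ≡ cubeSum n (fibreErrors S g)
    errors = trans (countCube≡cubeSum (n + m) _) (cubeSum-split n m (λ x y → 𝟙 (f S x y xor g x y)))

  -- each i with n + i ∈ J is hit by 2^(n - t) points x, and there are at most k such i
  hits-bound : ∀ {n m} t k (S : Fin m → Subset n) (J : Subset (n + m)) →
    (∀ i → ∣ S i ∣ ≡ t) → ∣ J ∣ ≤ k → cubeSum n (hits J S) * 2 ^ t ≤ k * 2 ^ n
  hits-bound {n} {m} t k S J |S|≡t |J|≤k = begin
    cubeSum n (hits J S) * 2 ^ t
      ≡⟨ cong (_* 2 ^ t) (cubeSum-finSum n m _) ⟩
    finSum m (λ i → hitsOf i) * 2 ^ t
      ≡⟨ sym (finSum-*ʳ m _ _) ⟩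
    finSum m (λ i → hitsOf i * 2 ^ t)
      ≡⟨ finSum-cong m hitsOf-size ⟩
    finSum m (λ i → inJ i * 2 ^ n)
      ≡⟨ finSum-*ʳ m _ inJ ⟩
    finSum m inJ * 2 ^ n
      ≤⟨ *-monoˡ-≤ (2 ^ n) (≤-trans (finSum-↑ʳ≤∣∣ n m J) |J|≤k) ⟩
    k * 2 ^ n ∎
    where
    open ≤-Reasoning
    inJ : Fin m → ℕ
    inJ i = 𝟙 (lookup J (n ↑ʳ i))
    subcube : Fin m → ℕ
    subcube i = cubeSum n (λ x → 𝟙 (allOnes (S i) x))
    hitsOf : Fin m → ℕ
    hitsOf i = cubeSum n (λ x → inJ i * 𝟙 (allOnes (S i) x))
    hitsOf-size : ∀ i → hitsOf i * 2 ^ t ≡ inJ i * 2 ^ n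
    hitsOf-size i = Eq.begin
      hitsOf i * 2 ^ t               Eq.≡⟨ cong (_* 2 ^ t) (cubeSum-*ˡ n (inJ i) _) ⟩
      inJ i * subcube i * 2 ^ t      Eq.≡⟨ *-assoc (inJ i) _ _ ⟩
      inJ i * (subcube i * 2 ^ t)    Eq.≡⟨ cong (λ s → inJ i * (subcube i * 2 ^ s)) (sym (|S|≡t i)) ⟩
      inJ i * (subcube i * 2 ^ ∣ S i ∣) Eq.≡⟨ cong (inJ i *_) (subcube-size n (S i)) ⟩
      inJ i * 2 ^ n                  Eq.∎
      where module Eq = ≡-Reasoning

  counting-bound : ∀ {n m} t k (S : Fin m → Subset n) (g : Vec Bool n → Vec Bool m → Bool) →
    (∀ i → ∣ S i ∣ ≡ t) → IsJunta k g →
    countCube n (|T|≡1 S) * 2 ^ m * 2 ^ t ≤ 2 * countCube (n + m) (errorEvent S g) * 2 ^ t + k * 2 ^ n * 2 ^ m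
  counting-bound {n} {m} t k S g |S|≡t (J , |J|≤k , determined) = begin
    A * M * 2 ^ t                  ≤⟨ *-monoˡ-≤ (2 ^ t) (error-bound S determined) ⟩
    (2 * E + M * H) * 2 ^ t        ≡⟨ *-distribʳ-+ (2 ^ t) (2 * E) (M * H) ⟩
    2 * E * 2 ^ t + M * H * 2 ^ t  ≡⟨ cong (2 * E * 2 ^ t +_) (*-assoc M H (2 ^ t)) ⟩
    2 * E * 2 ^ t + M * (H * 2 ^ t) ≤⟨ +-monoʳ-≤ (2 * E * 2 ^ t) (*-monoʳ-≤ M (hits-bound t k S J |S|≡t |J|≤k)) ⟩
    2 * E * 2 ^ t + M * (k * 2 ^ n) ≡⟨ cong (2 * E * 2 ^ t +_) (*-comm M (k * 2 ^ n)) ⟩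
    2 * E * 2 ^ t + k * 2 ^ n * M  ∎
    where
    open ≤-Reasoning
    M A E H : ℕ
    M = 2 ^ m
    A = countCube n (|T|≡1 S)
    E = countCube (n + m) (errorEvent S g)
    H = cubeSum n (hits J S)

module Fractions where
  open import Data.Nat as ℕ using (ℕ; suc; NonZero)
  open import Data.Integer as ℤ using (ℤ; +_; +≤+)
  open import Data.Integer.Properties as ℤP using (pos-+; pos-*)
  open import Data.Integer.Tactic.RingSolver using (solve-∀)
  open import Data.Rational using (ℚ; _/_; _-_; -_; _*_; ½; toℚᵘ) renaming (_≤_ to _≤ℚ_)
  open import Data.Rational.Properties using (toℚᵘ-cancel-≤; toℚᵘ-fromℚᵘ; toℚᵘ-homo-*; toℚᵘ-homo-+; toℚᵘ-homo‿-)
  open import Data.Rational.Unnormalised as U using (mkℚᵘ; *≤*)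
  import Data.Rational.Unnormalised.Properties as UP
  open import Relation.Binary.PropositionalEquality

  toℚᵘ-/ : ∀ c D → toℚᵘ (+ c / suc D) U.≃ mkℚᵘ (+ c) D
  toℚᵘ-/ c D = toℚᵘ-fromℚᵘ (mkℚᵘ (+ c) D)

  -- the unnormalised comparison (A/N - k/T)·½ ≤ E/(N·M), multiplied out over ℤ,
  -- follows from the natural-number inequality times N
  crossMultiplied : ∀ A E k N M T →
    A ℕ.* M ℕ.* T ℕ.≤ 2 ℕ.* E ℕ.* T ℕ.+ k ℕ.* N ℕ.* M →
    ((+ A ℤ.* + T ℤ.+ ℤ.- (+ k) ℤ.* + N) ℤ.* + 1) ℤ.* + (N ℕ.* M) ℤ.≤ + E ℤ.* + (N ℕ.* T ℕ.* 2)
  crossMultiplied A E k N M T h = begin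
    ((a ℤ.* t ℤ.+ ℤ.- κ ℤ.* n) ℤ.* + 1) ℤ.* + (N ℕ.* M)
      ≡⟨ cong (((a ℤ.* t ℤ.+ ℤ.- κ ℤ.* n) ℤ.* + 1) ℤ.*_) (pos-* N M) ⟩
    ((a ℤ.* t ℤ.+ ℤ.- κ ℤ.* n) ℤ.* + 1) ℤ.* (n ℤ.* m)
      ≡⟨ expandˡ a κ n m t ⟩
    n ℤ.* (a ℤ.* m ℤ.* t) ℤ.- n ℤ.* (κ ℤ.* n ℤ.* m)
      ≤⟨ ℤP.+-monoˡ-≤ _ (ℤP.*-monoˡ-≤-nonNeg n hℤ) ⟩
    n ℤ.* (+ 2 ℤ.* e ℤ.* t ℤ.+ κ ℤ.* n ℤ.* m) ℤ.- n ℤ.* (κ ℤ.* n ℤ.* m)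
      ≡⟨ expandʳ e κ n m t ⟩
    e ℤ.* (n ℤ.* t ℤ.* + 2)
      ≡⟨ cong (e ℤ.*_) (sym (trans (pos-* (N ℕ.* T) 2) (cong (ℤ._* + 2) (pos-* N T)))) ⟩
    e ℤ.* + (N ℕ.* T ℕ.* 2) ∎
    where
    open ℤP.≤-Reasoning
    a e κ n m t : ℤ
    a = + A ; e = + E ; κ = + k ; n = + N ; m = + M ; t = + T
    pos-*³ : ∀ x y z → + (x ℕ.* y ℕ.* z) ≡ + x ℤ.* + y ℤ.* + z
    pos-*³ x y z = trans (pos-* (x ℕ.* y) z) (cong (ℤ._* + z) (pos-* x y))
    hℤ : a ℤ.* m ℤ.* t ℤ.≤ + 2 ℤ.* e ℤ.* t ℤ.+ κ ℤ.* n ℤ.* m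
    hℤ = subst₂ ℤ._≤_ (pos-*³ A M T)
      (trans (pos-+ (2 ℕ.* E ℕ.* T) (k ℕ.* N ℕ.* M)) (cong₂ ℤ._+_ (pos-*³ 2 E T) (pos-*³ k N M)))
      (+≤+ h)
    expandˡ : ∀ a κ n m t → ((a ℤ.* t ℤ.+ ℤ.- κ ℤ.* n) ℤ.* + 1) ℤ.* (n ℤ.* m)
      ≡ n ℤ.* (a ℤ.* m ℤ.* t) ℤ.- n ℤ.* (κ ℤ.* n ℤ.* m)
    expandˡ = solve-∀
    expandʳ : ∀ e κ n m t → n ℤ.* (+ 2 ℤ.* e ℤ.* t ℤ.+ κ ℤ.* n ℤ.* m) ℤ.- n ℤ.* (κ ℤ.* n ℤ.* m)
      ≡ e ℤ.* (n ℤ.* t ℤ.* + 2)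
    expandʳ = solve-∀

  halfDifference≤ : ∀ A E k N M T NM .{{_ : NonZero N}} .{{_ : NonZero M}} .{{_ : NonZero T}}
    .{{_ : NonZero NM}} → NM ≡ N ℕ.* M →
    A ℕ.* M ℕ.* T ℕ.≤ 2 ℕ.* E ℕ.* T ℕ.+ k ℕ.* N ℕ.* M →
    (+ A / N - + k / T) * ½ ≤ℚ + E / NM
  halfDifference≤ A E k (suc N′) (suc M′) (suc T′) .(suc N′ ℕ.* suc M′) refl h =
    toℚᵘ-cancel-≤ (UP.≤-respˡ-≃ (UP.≃-sym lhs≃) (UP.≤-respʳ-≃ (UP.≃-sym (toℚᵘ-/ E _))
      (*≤* (crossMultiplied A E k (suc N′) (suc M′) (suc T′) h))))
    where
    a b : ℚ
    a = + A / suc N′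
    b = + k / suc T′
    lhs≃ : toℚᵘ ((a - b) * ½) U.≃ (mkℚᵘ (+ A) N′ U.+ U.- mkℚᵘ (+ k) T′) U.* mkℚᵘ (+ 1) 1
    lhs≃ = UP.≃-trans (toℚᵘ-homo-* (a - b) ½)
      (UP.*-cong (UP.≃-trans (toℚᵘ-homo-+ a (- b))
        (UP.+-cong (toℚᵘ-/ A N′) (UP.≃-trans (toℚᵘ-homo‿- b) (UP.-‿cong (toℚᵘ-/ k T′))))) UP.≃-refl)

open import Defs
open import Data.Bool using (Bool; _xor_)
open import Data.Nat using (ℕ; _+_; _^_; _≤_; _∸_)
open import Data.Nat.Properties using (m^n≢0; ^-distribˡ-+-*)
open import Data.Integer using (+_)
open import Data.Rational using (ℚ; _/_; _-_; _*_; ½) renaming (_≤_ to _≤ℚ_)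
open import Data.Fin using (Fin)
open import Data.Fin.Subset using (Subset; ∣_∣)
open import Data.Vec using (Vec)
open import Data.Product using (proj₁; proj₂)
open import Relation.Binary.PropositionalEquality using (_≡_)

open Counting using (errorEvent; counting-bound)
open Fractions using (halfDifference≤)

lemma2 : (d t m k : ℕ) → 1 ≤ d → 1 ≤ t → 1 ≤ m → 1 ≤ k →
    (S : Fin m → Subset (d ∸ 1)) → (∀ i → ∣ S i ∣ ≡ t) →
    (g : Vec Bool (d ∸ 1) → Vec Bool m → Bool) → IsJunta k g →
    (Pr (d ∸ 1) (|T|≡1 S) - _/_ (+ k) (2 ^ t) {{m^n≢0 2 t}}) * ½
      ≤ℚ Pr ((d ∸ 1) + m) (λ z → f S (proj₁ (split (d ∸ 1) z)) (proj₂ (split (d ∸ 1) z)) xor g (proj₁ (split (d ∸ 1) z)) (proj₂ (split (d ∸ 1) z)))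
lemma2 d t m k _ _ _ _ S |S|≡t g junta =
  halfDifference≤ (countCube n (|T|≡1 S)) (countCube (n + m) (errorEvent S g)) k
    (2 ^ n) (2 ^ m) (2 ^ t) (2 ^ (n + m))
    {{m^n≢0 2 n}} {{m^n≢0 2 m}} {{m^n≢0 2 t}} {{m^n≢0 2 (n + m)}}
    (^-distribˡ-+-* 2 n m)
    (counting-bound t k S g |S|≡t junta)
  where
  n : ℕ
  n = d ∸ 1
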